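{- Let $G$ be a strict episode and let $H$ be a state of the machine $M(G)$. Then the labels of the outgoing edges of $H$ in $M(G)$ are pairwise distinct (each outgoing edge has a label that is unique among the outgoing edges of $H$), and the labels of the incoming edges of $H$ in $M(G)$ are pairwise distinct (each incoming edge has a label that is unique among the incoming edges of $H$).
   Context: Fix a finite alphabet $\Sigma$. An episode $G=(V,E,\mathrm{lab})$ is a directed acyclic graph with vertex set $V$, edge set $E$ and a labelling $\mathrm{lab}:V\to\Sigma$; episodes are assumed transitively closed. $G$ is strict if for any two distinct vertices $v,w\in V$ with $\mathrm{lab}(v)=\mathrm{lab}(w)$ we have $(v,w)\in E$ or $(w,v)\in E$. For $W\subseteq V$, the induced episode $G(W)$ has vertices $W$, edges $\{(v,w)\in E: v,w\in W\}$ and the same labels. $G(W)$ is a prefix subgraph if $v\in W$ and $(w,v)\in E$ imply $w\in W$. The machine $M(G)$ is the directed graph with labelled edges whose states are the prefix subgraphs of $G$, with an edge $(H_1,H_2)$ whenever $H_1$ is obtained from $H_2$ by deleting a single (sink) vertex of $H_2$; the label of that edge is the label of the deleted vertex. -}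

module Defs where

open import Data.Nat using (ℕ)
open import Data.Fin using (Fin)
open import Data.Fin.Subset using (Subset; _∈_; _-_)
open import Data.Product using (_×_)
open import Data.Sum using (_⊎_)
open import Relation.Nullary using (¬_)
open import Relation.Binary.PropositionalEquality using (_≡_; _≢_)
open import Relation.Binary.Construct.Closure.Transitive using (TransClosure)

record Episode (k : ℕ) : Set₁ where
  field
    n   : ℕ
    E   : Fin n → Fin n → Set
    lab : Fin n → Fin k
    acyclic : ∀ v → ¬ TransClosure E v v
    trans   : ∀ {u v w} → E u v → E v w → E u w

open Episode public

Strict : ∀ {k} → Episode k → Set
Strict G = ∀ v w → v ≢ w → lab G v ≡ lab G w → E G v w ⊎ E G w v

-- A vertex set W ⊆ V gives a prefix subgraph G(W) (a state of M(G))
IsPrefix : ∀ {k} (G : Episode k) → Subset (n G) → Set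
IsPrefix G W = ∀ {v w} → v ∈ W → E G w v → w ∈ W

IsSink : ∀ {k} (G : Episode k) → Subset (n G) → Fin (n G) → Set
IsSink G W v = v ∈ W × (∀ w → w ∈ W → ¬ E G v w)

-- Edge (G(W₁), G(W₂)) of M(G) obtained by deleting the sink vertex v of G(W₂);
-- its label is lab v.  States are identified with their vertex sets.
MEdge : ∀ {k} (G : Episode k) → Subset (n G) → Subset (n G) → Fin (n G) → Set
MEdge G W₁ W₂ v = IsSink G W₂ v × W₁ ≡ W₂ - v

-- Deleting a vertex is injective on the sets that contain it, so two outgoing
-- edges H → H₁, H → H₂ with the same label and H₁ ≠ H₂ delete distinct
-- vertices v ∈ H₁, w ∈ H₂. Strictness makes them comparable, say v → w; then
-- v ∈ H₂ since H₂ is a prefix, so v ∈ H₂ - w = H = H₁ - v, which is absurd.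
-- Dually, two incoming edges with the same label delete two sinks of H, and
-- distinct sinks are incomparable, hence carry distinct labels.
module Submission where

open import Defs hiding (trans)
open import Data.Nat using (ℕ)
open import Data.Fin using (Fin; _≟_)
open import Data.Fin.Subset using (Subset; _∈_; _∉_; _⊆_; _─_; _-_; ⁅_⁆)
open import Data.Fin.Subset.Properties
  using (drop-there; x∈⁅x⁆; p─q⊆p; x∈p∧x≢y⇒x∈p-y; ⊆-antisym)
open import Data.Vec using (_∷_; here; there)
open import Data.Product using (_×_; _,_)
open import Data.Sum using (inj₁; inj₂)
open import Function using (_∘_)
open import Relation.Nullary using (yes; no; contradiction)
open import Relation.Binary.PropositionalEquality using (_≡_; refl; sym; trans; subst)

private
  variable
    m : ℕ
    p q : Subset m
    x : Fin m

x∈q⇒x∉p─q : x ∈ q → x ∉ p ─ q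
x∈q⇒x∉p─q {p = _ ∷ _} here      ()
x∈q⇒x∉p─q {p = _ ∷ _} (there x∈q) x∈p─q = x∈q⇒x∉p─q x∈q (drop-there x∈p─q)

x∉p-x : ∀ (p : Subset m) x → x ∉ p - x
x∉p-x p x = x∈q⇒x∉p─q (x∈⁅x⁆ x)

x∈q∧p-x⊆q-x⇒p⊆q : x ∈ q → p - x ⊆ q - x → p ⊆ q
x∈q∧p-x⊆q-x⇒p⊆q {x = x} {q = q} {p = p} x∈q p-x⊆q-x {y} y∈p with y ≟ x
... | yes refl = x∈q
... | no y≢x   = p─q⊆p q ⁅ x ⁆ (p-x⊆q-x (x∈p∧x≢y⇒x∈p-y y∈p y≢x))

-x-injective : x ∈ p → x ∈ q → p - x ≡ q - x → p ≡ q
-x-injective x∈p x∈q p-x≡q-x = ⊆-antisym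
  (x∈q∧p-x⊆q-x⇒p⊆q x∈q (subst (_ ∈_) p-x≡q-x))
  (x∈q∧p-x⊆q-x⇒p⊆q x∈p (subst (_ ∈_) (sym p-x≡q-x)))

module _ {k} (G : Episode k) (strict : Strict G) where

  sink-lab-injective : ∀ {W v w} → IsSink G W v → IsSink G W w →
                       lab G v ≡ lab G w → v ≡ w
  sink-lab-injective {v = v} {w} (v∈W , v-sink) (w∈W , w-sink) lv≡lw with v ≟ w
  ... | yes v≡w = v≡w
  ... | no v≢w with strict v w v≢w lv≡lw
  ...   | inj₁ v→w = contradiction v→w (v-sink w w∈W)
  ...   | inj₂ w→v = contradiction w→v (w-sink v v∈W)

  deletion-lab-injective : ∀ {W₁ W₂ v w} → IsPrefix G W₁ → IsPrefix G W₂ →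
                           v ∈ W₁ → w ∈ W₂ → W₁ - v ≡ W₂ - w →
                           lab G v ≡ lab G w → v ≡ w
  deletion-lab-injective {W₁} {W₂} {v} {w} W₁-prefix W₂-prefix v∈W₁ w∈W₂ W₁-v≡W₂-w lv≡lw
    with v ≟ w
  ... | yes v≡w = v≡w
  ... | no v≢w with strict v w v≢w lv≡lw
  ...   | inj₁ v→w = contradiction
          (subst (v ∈_) (sym W₁-v≡W₂-w) (x∈p∧x≢y⇒x∈p-y (W₂-prefix w∈W₂ v→w) v≢w))
          (x∉p-x W₁ v)
  ...   | inj₂ w→v = contradiction
          (subst (w ∈_) W₁-v≡W₂-w (x∈p∧x≢y⇒x∈p-y (W₁-prefix v∈W₁ w→v) (v≢w ∘ sym)))
          (x∉p-x W₂ w)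

  out-edges-lab-injective : ∀ H (H₁ H₂ : Subset (n G)) v w →
                            IsPrefix G H₁ → IsPrefix G H₂ →
                            MEdge G H H₁ v → MEdge G H H₂ w →
                            lab G v ≡ lab G w → H₁ ≡ H₂
  out-edges-lab-injective H H₁ H₂ v w H₁-prefix H₂-prefix
    ((v∈H₁ , _) , H≡H₁-v) ((w∈H₂ , _) , H≡H₂-w) lv≡lw
    with H₁-v≡H₂-w ← trans (sym H≡H₁-v) H≡H₂-w
    with refl ← deletion-lab-injective H₁-prefix H₂-prefix v∈H₁ w∈H₂ H₁-v≡H₂-w lv≡lw
    = -x-injective v∈H₁ w∈H₂ H₁-v≡H₂-w

  in-edges-lab-injective : ∀ H (H₁ H₂ : Subset (n G)) v w →
                           MEdge G H₁ H v → MEdge G H₂ H w →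
                           lab G v ≡ lab G w → H₁ ≡ H₂
  in-edges-lab-injective H H₁ H₂ v w (v-sink , H₁≡H-v) (w-sink , H₂≡H-w) lv≡lw
    with refl ← sink-lab-injective v-sink w-sink lv≡lw
    = trans H₁≡H-v (sym H₂≡H-w)

lemma1 : ∀ {k} (G : Episode k) → Strict G →
         ∀ (H : Subset (n G)) → IsPrefix G H →
         ((H₁ H₂ : Subset (n G)) (v w : Fin (n G)) →
            IsPrefix G H₁ → IsPrefix G H₂ →
            MEdge G H H₁ v → MEdge G H H₂ w →
            lab G v ≡ lab G w → H₁ ≡ H₂)
         ×
         ((H₁ H₂ : Subset (n G)) (v w : Fin (n G)) →
            IsPrefix G H₁ → IsPrefix G H₂ →
            MEdge G H₁ H v → MEdge G H₂ H w →
            lab G v ≡ lab G w → H₁ ≡ H₂)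
lemma1 G strict H _ =
  out-edges-lab-injective G strict H ,
  λ H₁ H₂ v w _ _ → in-edges-lab-injective G strict H H₁ H₂ v w
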